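{- A permutation $\pi$ belongs to $\mathcal{C}_{1,1}\cap\mathrm{Av}(3142)$ if and only if $\pi$ has a spiral decomposition. Moreover, every permutation in $\mathcal{C}_{1,1}\cap\mathrm{Av}(3142)$ has a spiral decomposition with no four consecutive empty blocks.
   Context: $\mathcal{C}_{1,1}$ is the set of permutations that can be partitioned into one increasing and one decreasing (possibly empty) subsequence; $\mathrm{Av}(3142)$ is the set of permutations not containing $3142$ as a pattern (a permutation $\tau$ contains $\sigma$ if some subsequence of $\tau$ has entries in the same relative order as $\sigma$). For elements of a permutation, $x$ is above $y$ if $x>y$ and $x$ is left of $y$ if it occurs earlier; for sets of elements the relation must hold for all pairs (vacuously true if a set is empty). A spiral decomposition of a permutation $\pi$ is a partition of the elements of $\pi$ into a sequence $B_1,\dots,B_m$ of possibly empty subsets (blocks) such that: (a) $B_i$ is a decreasing subsequence for $i$ odd and an increasing subsequence for $i$ even; (b) writing $B_{>i}=\bigcup_{j>i}B_j$ and $r_i\in\{0,1,2,3\}$ for the remainder of $i$ modulo $4$: if $r_i=0$ then $B_i$ is above $B_{i-1}$ and $B_{>i}$ is above and to the left of $B_{i-1}$; if $r_i=1$ and $i>1$ then $B_i$ is to the left of $B_{i-1}$ and $B_{>i}$ is below and to the left of $B_{i-1}$; if $r_i=2$ then $B_i$ is below $B_{i-1}$ and $B_{>i}$ is below and to the right of $B_{i-1}$; if $r_i=3$ then $B_i$ is to the right of $B_{i-1}$ and $B_{>i}$ is above and to the right of $B_{i-1}$. -}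

module Defs where

open import Data.Nat using (ℕ; zero; suc; _+_; _∸_; _≤_; _%_)
open import Data.Fin using (Fin; _<_; _>_)
open import Data.Fin.Permutation using (Permutation′; _⟨$⟩ʳ_)
open import Data.Vec using (Vec; lookup; _∷_; [])
open import Data.Bool using (Bool; true; false)
open import Data.Product using (Σ; _×_; ∃; ∃-syntax)
open import Relation.Binary.PropositionalEquality using (_≡_; _≢_)
open import Relation.Nullary using (¬_)
open import Function.Bundles using (_⇔_)

-- A permutation of size n is a bijection Fin n → Fin n; element at position p has value π ⟨$⟩ʳ p.

Contains : ∀ {n k} → Permutation′ n → Permutation′ k → Set
Contains {n} {k} τ σ =
  Σ (Fin k → Fin n) λ f →
    (∀ i j → i < j → f i < f j) ×
    (∀ i j → (σ ⟨$⟩ʳ i < σ ⟨$⟩ʳ j) ⇔ (τ ⟨$⟩ʳ f i < τ ⟨$⟩ʳ f j))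

Avoids : ∀ {n k} → Permutation′ n → Permutation′ k → Set
Avoids τ σ = ¬ Contains τ σ

-- The pattern 3142 (0-indexed values 2,0,3,1).
open import Data.Fin.Base using (zero; suc)
private
  f3142 : Fin 4 → Fin 4
  f3142 zero = suc (suc zero)
  f3142 (suc zero) = zero
  f3142 (suc (suc zero)) = suc (suc (suc zero))
  f3142 (suc (suc (suc zero))) = suc zero

  g3142 : Fin 4 → Fin 4
  g3142 zero = suc zero
  g3142 (suc zero) = suc (suc (suc zero))
  g3142 (suc (suc zero)) = zero
  g3142 (suc (suc (suc zero))) = suc (suc zero)

  fg : ∀ i → f3142 (g3142 i) ≡ i
  fg zero = _≡_.refl
  fg (suc zero) = _≡_.refl
  fg (suc (suc zero)) = _≡_.refl
  fg (suc (suc (suc zero))) = _≡_.refl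

  gf : ∀ i → g3142 (f3142 i) ≡ i
  gf zero = _≡_.refl
  gf (suc zero) = _≡_.refl
  gf (suc (suc zero)) = _≡_.refl
  gf (suc (suc (suc zero))) = _≡_.refl

open import Data.Fin.Permutation using (permutation)

p3142 : Permutation′ 4
p3142 = permutation f3142 g3142 fg gf

Av3142 : ∀ {n} → Permutation′ n → Set
Av3142 π = Avoids π p3142

C11 : ∀ {n} → Permutation′ n → Set
C11 {n} π = Σ (Fin n → Bool) λ c →
  (∀ p q → p < q → c p ≡ true → c q ≡ true → π ⟨$⟩ʳ p < π ⟨$⟩ʳ q) ×
  (∀ p q → p < q → c p ≡ false → c q ≡ false → π ⟨$⟩ʳ p > π ⟨$⟩ʳ q)

-- Spiral decomposition with m blocks B_1..B_m (1-indexed); the element at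
-- position p lies in block  blk p ∈ {1..m}.
module _ {n : ℕ} (π : Permutation′ n) (m : ℕ) (blk : Fin n → ℕ) where
  val : Fin n → Fin n
  val p = π ⟨$⟩ʳ p

  AboveB : (ℕ → Set) → (ℕ → Set) → Set
  AboveB X Y = ∀ p q → X (blk p) → Y (blk q) → val p > val q
  BelowB : (ℕ → Set) → (ℕ → Set) → Set
  BelowB X Y = ∀ p q → X (blk p) → Y (blk q) → val p < val q
  LeftB : (ℕ → Set) → (ℕ → Set) → Set
  LeftB X Y = ∀ p q → X (blk p) → Y (blk q) → p < q
  RightB : (ℕ → Set) → (ℕ → Set) → Set
  RightB X Y = ∀ p q → X (blk p) → Y (blk q) → p > q

  Is : ℕ → ℕ → Set
  Is i j = j ≡ i
  After : ℕ → ℕ → Set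
  After i j = suc i ≤ j

  -- condition (b) for block i (with i ≥ 2), according to r = i mod 4
  CondB : ℕ → ℕ → Set
  CondB 0 i = AboveB (Is i) (Is (i ∸ 1)) ×
              AboveB (After i) (Is (i ∸ 1)) × LeftB (After i) (Is (i ∸ 1))
  CondB 1 i = LeftB (Is i) (Is (i ∸ 1)) ×
              BelowB (After i) (Is (i ∸ 1)) × LeftB (After i) (Is (i ∸ 1))
  CondB 2 i = BelowB (Is i) (Is (i ∸ 1)) ×
              BelowB (After i) (Is (i ∸ 1)) × RightB (After i) (Is (i ∸ 1))
  CondB _ i = RightB (Is i) (Is (i ∸ 1)) ×
              AboveB (After i) (Is (i ∸ 1)) × RightB (After i) (Is (i ∸ 1))

  Monotone : ℕ → Set
  Monotone i with i % 2
  ... | 1 = ∀ p q → p < q → blk p ≡ i → blk q ≡ i → val p > val q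
  ... | _ = ∀ p q → p < q → blk p ≡ i → blk q ≡ i → val p < val q

  record IsSpiralDecomposition : Set where
    field
      inRange   : ∀ p → 1 ≤ blk p × blk p ≤ m
      blocksMon : ∀ i → 1 ≤ i → i ≤ m → Monotone i
      blocksPos : ∀ i → 2 ≤ i → i ≤ m → CondB (i % 4) i

  EmptyBlock : ℕ → Set
  EmptyBlock i = ∀ p → blk p ≢ i

  NoFourConsecutiveEmpty : Set
  NoFourConsecutiveEmpty = ∀ i → 1 ≤ i → i + 3 ≤ m →
    ¬ (EmptyBlock i × EmptyBlock (i + 1) × EmptyBlock (i + 2) × EmptyBlock (i + 3))

HasSpiralDecomposition : ∀ {n} → Permutation′ n → Set
HasSpiralDecomposition {n} π =
  Σ ℕ λ m → Σ (Fin n → ℕ) λ blk → IsSpiralDecomposition π m blk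

-- Given a C₁,₁ colouring into an increasing (true) and a decreasing (false) class, the
-- blocks are peeled off greedily.  If all remaining points lie on the required side of the
-- last block, those outside the far quadrant of some point of that block are pairwise
-- "discordant" and form the next block: a concordant pair among them, together with a pair
-- witnessing that they are not far, would give two concordant pairs that are mutually
-- discordant, impossible since every concordant pair contains an increasing point.  A
-- quarter turn of the plane exchanges the two classes, so one argument serves all four
-- directions.  When nothing is left near the last block, a new spiral starts after at most
-- three empty blocks at the topmost, leftmost, bottommost or rightmost point, chosen by its
-- colour so that the next block is monotone; if none qualifies, the leftmost, bottommost,
-- topmost and rightmost points form a 3142.  Conversely, colouring by the parity of the
-- block index gives the C₁,₁ structure.
module Submission where

open import Defs
open import Data.Bool using (Bool; true; false; not; _∧_; if_then_else_; _≟_)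
open import Data.Bool.Properties using (not-injective; ¬-not)
open import Data.Empty using (⊥; ⊥-elim)
open import Data.Fin using (Fin; _<_; _<?_; toℕ)
open import Data.Fin.Patterns using (0F; 1F; 2F; 3F)
import Data.Fin.Properties as Fin
open import Data.Fin.Permutation using (Permutation′; _⟨$⟩ʳ_; _⟨$⟩ˡ_; inverseˡ)
open import Data.List using (List; []; _∷_; allFin; filter)
open import Data.List.Extrema.Nat
  using (argmax; argmin; argmax-all; argmin-all; f[xs]≤f[argmax]; f[argmin]≤f[xs])
open import Data.List.Membership.Propositional using (_∈_)
open import Data.List.Membership.Propositional.Properties using (∈-allFin; ∈-filter⁺)
import Data.List.Relation.Unary.All as All
open import Data.List.Relation.Unary.All.Properties using (all-filter)
open import Data.List.Relation.Unary.Any using (here; there)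
open import Data.Nat as ℕ using (ℕ; zero; suc; _+_; _∸_; _%_; _≤_; z≤n; s≤s)
import Data.Nat.Properties as ℕ
open import Data.Nat.Divisibility using (divides)
open import Data.Nat.DivMod using (m<n⇒m%n≡m; [m+n]%n≡m%n; m∣n⇒o%n%m≡o%m)
open import Data.Product using (Σ; _×_; _,_; ∃; ∃₂; proj₁; proj₂)
open import Data.Sum using (_⊎_; inj₁; inj₂)
open import Function using (flip; _on_; _∘_)
open import Function.Bundles using (_⇔_; mk⇔; Equivalence)
open import Level using (0ℓ)
open import Relation.Binary using (Rel; IsStrictTotalOrder; Tri; tri<; tri≈; tri>)
import Relation.Binary.Construct.Flip.EqAndOrd as Flip
open import Relation.Binary.Structures.Biased using (isStrictTotalOrderᶜ)
open import Relation.Binary.PropositionalEquality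
  using (_≡_; _≢_; refl; sym; trans; cong; subst; subst₂; isEquivalence; module ≡-Reasoning)
open import Relation.Nullary using (¬_; Dec; yes; no; does; ¬?)
open import Relation.Nullary.Decidable using (_×-dec_)

module _ {A B : Set} {_≺_ : Rel B 0ℓ} (f : A → B) (f-injective : ∀ {a b} → f a ≡ f b → a ≡ b) where

  isStrictTotalOrder-on-injective : IsStrictTotalOrder _≡_ _≺_ → IsStrictTotalOrder _≡_ (_≺_ on f)
  isStrictTotalOrder-on-injective sto = isStrictTotalOrderᶜ record
    { isEquivalence = isEquivalence
    ; trans = O.trans
    ; compare = λ a b → pullback (O.compare (f a) (f b)) }
    where
    module O = IsStrictTotalOrder sto
    pullback : ∀ {a b} → Tri (f a ≺ f b) (f a ≡ f b) (f b ≺ f a) → Tri (f a ≺ f b) (a ≡ b) (f b ≺ f a)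
    pullback (tri< x ¬e ¬y) = tri< x (λ e → ¬e (cong f e)) ¬y
    pullback (tri≈ ¬x e ¬y) = tri≈ ¬x (f-injective e) ¬y
    pullback (tri> ¬x ¬e y) = tri> ¬x (λ e → ¬e (cong f e)) y

module _ {A : Set} (X Y : Rel A 0ℓ) where

  Concordant Discordant : Rel A 0ℓ
  Concordant a b = (X a b × Y a b) ⊎ (X b a × Y b a)
  Discordant a b = (X a b × Y b a) ⊎ (X b a × Y a b)

  record C11Colouring : Set where
    field
      X-isStrictTotalOrder : IsStrictTotalOrder _≡_ X
      Y-isStrictTotalOrder : IsStrictTotalOrder _≡_ Y
      colour : A → Bool
      true-concordant  : ∀ a b → a ≢ b → colour a ≡ true → colour b ≡ true → Concordant a b
      false-discordant : ∀ a b → a ≢ b → colour a ≡ false → colour b ≡ false → Discordant a b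

-- A quarter turn of the plane; it exchanges the increasing and decreasing classes.
rotate : ∀ {A : Set} {X Y : Rel A 0ℓ} → C11Colouring X Y → C11Colouring Y (flip X)
rotate {X = X} {Y} κ = record
  { X-isStrictTotalOrder = Y-isStrictTotalOrder
  ; Y-isStrictTotalOrder = Flip.isStrictTotalOrder X-isStrictTotalOrder
  ; colour = λ a → not (colour a)
  ; true-concordant = λ a b a≢b ca cb →
      discordant⇒rotated (false-discordant a b a≢b (not-injective ca) (not-injective cb))
  ; false-discordant = λ a b a≢b ca cb →
      concordant⇒rotated (true-concordant a b a≢b (not-injective ca) (not-injective cb)) }
  where
  open C11Colouring κ
  discordant⇒rotated : ∀ {a b} → Discordant X Y a b → Concordant Y (flip X) a b
  discordant⇒rotated (inj₁ (x , y)) = inj₂ (y , x)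
  discordant⇒rotated (inj₂ (x , y)) = inj₁ (y , x)
  concordant⇒rotated : ∀ {a b} → Concordant X Y a b → Discordant Y (flip X) a b
  concordant⇒rotated (inj₁ (x , y)) = inj₁ (y , x)
  concordant⇒rotated (inj₂ (x , y)) = inj₂ (y , x)

module C11Colouring-properties {A : Set} {X Y : Rel A 0ℓ} (κ : C11Colouring X Y) where
  open C11Colouring κ
  private
    module X = IsStrictTotalOrder X-isStrictTotalOrder
    module Y = IsStrictTotalOrder Y-isStrictTotalOrder

  concordant⇒¬discordant : ∀ {a b} → Concordant X Y a b → ¬ Discordant X Y a b
  concordant⇒¬discordant (inj₁ (_ , y)) (inj₁ (_ , y′)) = Y.asym y y′
  concordant⇒¬discordant (inj₁ (x , _)) (inj₂ (x′ , _)) = X.asym x x′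
  concordant⇒¬discordant (inj₂ (x , _)) (inj₁ (x′ , _)) = X.asym x x′
  concordant⇒¬discordant (inj₂ (_ , y)) (inj₂ (_ , y′)) = Y.asym y y′

  concordant⇒≢ : ∀ {a b} → Concordant X Y a b → a ≢ b
  concordant⇒≢ (inj₁ (x , _)) refl = X.irrefl refl x
  concordant⇒≢ (inj₂ (x , _)) refl = X.irrefl refl x

  discordant⇒≢ : ∀ {a b} → Discordant X Y a b → a ≢ b
  discordant⇒≢ (inj₁ (x , _)) refl = X.irrefl refl x
  discordant⇒≢ (inj₂ (x , _)) refl = X.irrefl refl x

  concordant⊎discordant : ∀ {a b} → a ≢ b → Concordant X Y a b ⊎ Discordant X Y a b
  concordant⊎discordant {a} {b} a≢b with X.compare a b | Y.compare a b
  ... | tri≈ _ a≡b _ | _            = ⊥-elim (a≢b a≡b)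
  ... | _            | tri≈ _ a≡b _ = ⊥-elim (a≢b a≡b)
  ... | tri< x _ _   | tri< y _ _   = inj₁ (inj₁ (x , y))
  ... | tri< x _ _   | tri> _ _ y   = inj₂ (inj₁ (x , y))
  ... | tri> _ _ x   | tri< y _ _   = inj₂ (inj₂ (x , y))
  ... | tri> _ _ x   | tri> _ _ y   = inj₁ (inj₂ (x , y))

  concordant⇒colour-true : ∀ {a b} → Concordant X Y a b → colour a ≡ true ⊎ colour b ≡ true
  concordant⇒colour-true {a} {b} ab with colour a in ca | colour b in cb
  ... | true  | _     = inj₁ refl
  ... | false | true  = inj₂ refl
  ... | false | false = ⊥-elim (concordant⇒¬discordant ab (false-discordant a b (concordant⇒≢ ab) ca cb))

  -- Each concordant pair contains a true element, and two true elements are concordant.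
  concordant-pairs-not-discordant : ∀ {a b c d} → Concordant X Y a b → Concordant X Y c d →
    Discordant X Y a c → Discordant X Y a d → Discordant X Y b c → Discordant X Y b d → ⊥
  concordant-pairs-not-discordant {a} {b} {c} {d} ab cd ac ad bc bd
    with concordant⇒colour-true ab | concordant⇒colour-true cd
  ... | inj₁ ta | inj₁ tc = concordant⇒¬discordant (true-concordant a c (discordant⇒≢ ac) ta tc) ac
  ... | inj₁ ta | inj₂ td = concordant⇒¬discordant (true-concordant a d (discordant⇒≢ ad) ta td) ad
  ... | inj₂ tb | inj₁ tc = concordant⇒¬discordant (true-concordant b c (discordant⇒≢ bc) tb tc) bc
  ... | inj₂ tb | inj₂ td = concordant⇒¬discordant (true-concordant b d (discordant⇒≢ bd) tb td) bd

  concordant-with-false⇒concordant : ∀ {e p q} → colour e ≡ false →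
    Concordant X Y p e → Concordant X Y q e → p ≢ q → Concordant X Y p q
  concordant-with-false⇒concordant {e} {p} {q} ce pe qe p≢q =
    true-concordant p q p≢q (colour-true pe) (colour-true qe)
    where
    colour-true : ∀ {a} → Concordant X Y a e → colour a ≡ true
    colour-true {a} ae with concordant⇒colour-true ae
    ... | inj₁ ca = ca
    ... | inj₂ ce′ with trans (sym ce) ce′
    ...   | ()

  concordant-if-not-X-above : ∀ {x e} → x ≢ e → ¬ X e x → Y x e → Concordant X Y x e
  concordant-if-not-X-above {x} {e} x≢e ¬Xex Yxe with X.compare x e
  ... | tri< Xxe _ _ = inj₁ (Xxe , Yxe)
  ... | tri≈ _ x≡e _ = ⊥-elim (x≢e x≡e)
  ... | tri> _ _ Xex = ⊥-elim (¬Xex Xex)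

  module Peel (R L : A → Set) (R-Y-before-L : ∀ l p → L l → R p → Y p l) where

    Beyond : A → A → Set
    Beyond l p = Y p l × X l p

    Inner Outer : A → Set
    Inner q = R q × ∃ λ l → L l × ¬ Beyond l q
    Outer p = R p × (∀ l → L l → Beyond l p)

    inner⇒X-Y-before : ∀ {q l} → R q → L l → ¬ Beyond l q → X q l × Y q l
    inner⇒X-Y-before {q} {l} rq ll ¬beyond with X.compare q l
    ... | tri< x _ _  = x , R-Y-before-L l q ll rq
    ... | tri≈ _ refl _ = ⊥-elim (Y.irrefl refl (R-Y-before-L l q ll rq))
    ... | tri> _ _ x  = ⊥-elim (¬beyond (R-Y-before-L l q ll rq , x))

    inner-X-outer : ∀ {q p} → Inner q → Outer p → X q p
    inner-X-outer (rq , l , ll , ¬beyond) (_ , outer) =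
      X.trans (proj₁ (inner⇒X-Y-before rq ll ¬beyond)) (proj₂ (outer l ll))

    NextInner : A → Set
    NextInner x = Outer x × ∃ λ q → Inner q × ¬ (X q x × Y q x)

    next-inner⇒Y-after-inner : ∀ {x} → NextInner x → ∃ λ q → Inner q × Y x q
    next-inner⇒Y-after-inner {x} (outer , q , inner , ¬XY) with Y.compare q x
    ... | tri< y _ _    = ⊥-elim (¬XY (inner-X-outer inner outer , y))
    ... | tri≈ _ refl _ = ⊥-elim (X.irrefl refl (inner-X-outer inner outer))
    ... | tri> _ _ y    = q , inner , y

    -- A concordant pair x, y of next inner elements and the pair (q, l) witnessing
    -- that y is next inner would be mutually discordant.
    next-inner-not-concordant : ∀ {x y} → NextInner x → NextInner y → X x y → Y x y → ⊥
    next-inner-not-concordant {x} {y} (outer-x , _) ny xy yxy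
      with next-inner⇒Y-after-inner ny
    ... | q , (rq , l , ll , ¬beyond) , yq with inner⇒X-Y-before rq ll ¬beyond
    ... | xql , yql =
      concordant-pairs-not-discordant {q} {l} {x} {y} (inj₁ (xql , yql)) (inj₁ (xy , yxy))
        (inj₁ (X.trans xql (proj₂ lx) , Y.trans yxy yq))
        (inj₁ (X.trans xql (proj₂ ly) , yq))
        (inj₁ (proj₂ lx , proj₁ lx))
        (inj₁ (proj₂ ly , proj₁ ly))
      where
      lx : Beyond l x
      lx = proj₂ outer-x l ll
      ly : Beyond l y
      ly = proj₂ (proj₁ ny) l ll

    next-inner-discordant : ∀ {x y} → NextInner x → NextInner y → x ≢ y → Discordant X Y x y
    next-inner-discordant nx ny x≢y with concordant⊎discordant x≢y
    ... | inj₂ d                   = d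
    ... | inj₁ (inj₁ (xy , yxy))   = ⊥-elim (next-inner-not-concordant nx ny xy yxy)
    ... | inj₁ (inj₂ (yx , yyx))   = ⊥-elim (next-inner-not-concordant ny nx yx yyx)

by-residue : ∀ {ℓ} (P : ℕ → ℕ → ℕ → Set ℓ) → P 0 1 1 → P 1 2 0 → P 2 3 1 → P 3 0 0 →
  ∀ i → P (i % 4) (suc i % 4) (suc i % 2)
by-residue P p₀ p₁ p₂ p₃ 0 = p₀
by-residue P p₀ p₁ p₂ p₃ 1 = p₁
by-residue P p₀ p₁ p₂ p₃ 2 = p₂
by-residue P p₀ p₁ p₂ p₃ 3 = p₃
by-residue P p₀ p₁ p₂ p₃ (suc (suc (suc (suc i)))) = by-residue P p₀ p₁ p₂ p₃ i

module Geometry {n : ℕ} (π : Permutation′ n) where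

  value : Fin n → Fin n
  value p = π ⟨$⟩ʳ p

  value-injective : ∀ {a b} → value a ≡ value b → a ≡ b
  value-injective e = trans (sym (inverseˡ π)) (trans (cong (π ⟨$⟩ˡ_) e) (inverseˡ π))

  LeftOf RightOf Below Above : Rel (Fin n) 0ℓ
  LeftOf a b = a < b
  RightOf = flip LeftOf
  Below a b = value a < value b
  Above = flip Below

  LeftOf-isStrictTotalOrder : IsStrictTotalOrder _≡_ LeftOf
  LeftOf-isStrictTotalOrder = Fin.<-isStrictTotalOrder

  Below-isStrictTotalOrder : IsStrictTotalOrder _≡_ Below
  Below-isStrictTotalOrder = isStrictTotalOrder-on-injective value value-injective Fin.<-isStrictTotalOrder

  -- The relation required by condition (b) between an element q of B_{i-1} and an
  -- element p of B_i (Adjacent) or of B_{>i} (Beyond), for i ≡ r (mod 4).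
  Adjacent Beyond : ℕ → Rel (Fin n) 0ℓ
  Adjacent 0 q p = Above p q
  Adjacent 1 q p = LeftOf p q
  Adjacent 2 q p = Below p q
  Adjacent (suc (suc (suc _))) q p = RightOf p q
  Beyond 0 q p = Above p q × LeftOf p q
  Beyond 1 q p = LeftOf p q × Below p q
  Beyond 2 q p = Below p q × RightOf p q
  Beyond (suc (suc (suc _))) q p = RightOf p q × Above p q

  -- Blocks of odd index are decreasing, those of even index increasing.
  Trend : ℕ → Rel (Fin n) 0ℓ
  Trend 1 p q = Above p q
  Trend _ p q = Below p q

  beyond⇒adjacent : ∀ r {q p} → Beyond r q p → Adjacent r q p
  beyond⇒adjacent 0 = proj₁
  beyond⇒adjacent 1 = proj₁
  beyond⇒adjacent 2 = proj₁
  beyond⇒adjacent (suc (suc (suc _))) = proj₁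

  beyond? : ∀ r q p → Dec (Beyond r q p)
  beyond? 0 q p = (value q <? value p) ×-dec (p <? q)
  beyond? 1 q p = (p <? q) ×-dec (value p <? value q)
  beyond? 2 q p = (value p <? value q) ×-dec (q <? p)
  beyond? (suc (suc (suc _))) q p = (q <? p) ×-dec (value q <? value p)

  beyond-forward : ∀ b {x y} → x < y → Beyond (suc b % 4) x y → Trend (b % 2) x y
  beyond-forward 0 x<y (y<x , _) = ⊥-elim (Fin.<-asym x<y y<x)
  beyond-forward 1 x<y (below , _) = below
  beyond-forward 2 x<y (_ , above) = above
  beyond-forward 3 x<y (_ , y<x) = ⊥-elim (Fin.<-asym x<y y<x)
  beyond-forward (suc (suc (suc (suc b)))) = beyond-forward b

  beyond-backward : ∀ b {x y} → x < y → Beyond (suc b % 4) y x → Trend (b % 2) x y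
  beyond-backward 0 x<y (_ , below) = below
  beyond-backward 1 x<y (_ , x>y) = ⊥-elim (Fin.<-asym x<y x>y)
  beyond-backward 2 x<y (x>y , _) = ⊥-elim (Fin.<-asym x<y x>y)
  beyond-backward 3 x<y (above , _) = above
  beyond-backward (suc (suc (suc (suc b)))) = beyond-backward b

  Inner Outer : ℕ → (Fin n → Set) → (Fin n → Set) → Fin n → Set
  Inner r R L q = R q × ∃ λ l → L l × ¬ Beyond r l q
  Outer r R L p = R p × (∀ l → L l → Beyond r l p)

  -- Removing the inner elements of R (those not beyond all of L) as the next block:
  -- what remains is adjacent to them, and the new inner elements follow the next trend.
  Peeled : ℕ → ℕ → ℕ → (Fin n → Set) → (Fin n → Set) → Set
  Peeled r r′ parity′ R L =
    (∀ q p → Inner r R L q → Outer r R L p → Adjacent r′ q p) ×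
    (∀ x y → x < y → Inner r′ (Outer r R L) (Inner r R L) x →
                     Inner r′ (Outer r R L) (Inner r R L) y → Trend parity′ x y)

  PeelStep : ℕ → ℕ → ℕ → Set₁
  PeelStep r r′ parity′ = ∀ (R L : Fin n → Set) → (∀ q p → L q → R p → Adjacent r q p) → Peeled r r′ parity′ R L

  -- A singleton block {e} from which a spiral on R can restart, its successor block
  -- having residue r.
  Start : ℕ → (Fin n → Bool) → Fin n → Set
  Start r R e = R e ≡ true × (∀ p → R p ≡ true → p ≢ e → Adjacent r e p) ×
    (∀ x y → x < y → R x ≡ true → R y ≡ true → x ≢ e → y ≢ e →
       ¬ Beyond r e x → ¬ Beyond r e y → Trend (r % 2) x y)

  module Coloured (c11 : C11 π) where

    colouring : C11Colouring LeftOf Below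
    colouring = record
      { X-isStrictTotalOrder = LeftOf-isStrictTotalOrder
      ; Y-isStrictTotalOrder = Below-isStrictTotalOrder
      ; colour = proj₁ c11
      ; true-concordant = λ a b a≢b → orient (proj₁ (proj₂ c11)) a≢b
      ; false-discordant = λ a b a≢b → orient (proj₂ (proj₂ c11)) a≢b }
      where
      orient : ∀ {b₀} {S : Rel (Fin n) 0ℓ} →
        (∀ p q → p < q → proj₁ c11 p ≡ b₀ → proj₁ c11 q ≡ b₀ → S p q) →
        ∀ {a b} → a ≢ b → proj₁ c11 a ≡ b₀ → proj₁ c11 b ≡ b₀ →
        (LeftOf a b × S a b) ⊎ (LeftOf b a × S b a)
      orient mono {a} {b} a≢b ca cb with Fin.<-cmp a b
      ... | tri< a<b _ _ = inj₁ (a<b , mono a b a<b ca cb)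
      ... | tri≈ _ a≡b _ = ⊥-elim (a≢b a≡b)
      ... | tri> _ _ b<a = inj₂ (b<a , mono b a b<a cb ca)

    -- The colouring seen from the frame of residue r: X is the direction of the
    -- adjacency of residue r + 1 and Y that of residue r.
    frame₂ : C11Colouring LeftOf Below
    frame₂ = colouring
    frame₃ : C11Colouring Below RightOf
    frame₃ = rotate frame₂
    frame₀ : C11Colouring RightOf Above
    frame₀ = rotate frame₃
    frame₁ : C11Colouring Above LeftOf
    frame₁ = rotate frame₀

    private
      module Peel {X Y : Rel (Fin n) 0ℓ} (κ : C11Colouring X Y) = C11Colouring-properties.Peel κ

    peel₂ : PeelStep 2 3 1
    peel₂ R L adj = (λ _ _ → P.inner-X-outer) ,
      λ x y x<y nx ny → trend x<y (P.next-inner-discordant nx ny (Fin.<⇒≢ x<y))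
      where
      module P = Peel frame₂ R L adj
      trend : ∀ {x y} → x < y → Discordant LeftOf Below x y → Above x y
      trend _   (inj₁ (_ , y<x)) = y<x
      trend x<y (inj₂ (y<x , _)) = ⊥-elim (Fin.<-asym x<y y<x)

    peel₃ : PeelStep 3 0 0
    peel₃ R L adj = (λ _ _ → P.inner-X-outer) ,
      λ x y x<y nx ny → trend x<y (P.next-inner-discordant nx ny (Fin.<⇒≢ x<y))
      where
      module P = Peel frame₃ R L adj
      trend : ∀ {x y} → x < y → Discordant Below RightOf x y → Below x y
      trend _   (inj₁ (x<y , _)) = x<y
      trend x<y (inj₂ (_ , y<x)) = ⊥-elim (Fin.<-asym x<y y<x)

    peel₀ : PeelStep 0 1 1
    peel₀ R L adj = (λ _ _ → P.inner-X-outer) ,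
      λ x y x<y nx ny → trend x<y (P.next-inner-discordant nx ny (Fin.<⇒≢ x<y))
      where
      module P = Peel frame₀ R L adj
      trend : ∀ {x y} → x < y → Discordant RightOf Above x y → Above x y
      trend x<y (inj₁ (y<x , _)) = ⊥-elim (Fin.<-asym x<y y<x)
      trend _   (inj₂ (_ , y<x)) = y<x

    peel₁ : PeelStep 1 2 0
    peel₁ R L adj = (λ _ _ → P.inner-X-outer) ,
      λ x y x<y nx ny → trend x<y (P.next-inner-discordant nx ny (Fin.<⇒≢ x<y))
      where
      module P = Peel frame₁ R L adj
      trend : ∀ {x y} → x < y → Discordant Above LeftOf x y → Below x y
      trend x<y (inj₁ (_ , y<x)) = ⊥-elim (Fin.<-asym x<y y<x)
      trend _   (inj₂ (x<y , _)) = x<y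

    peel : ∀ i → PeelStep (i % 4) (suc i % 4) (suc i % 2)
    peel = by-residue PeelStep peel₀ peel₁ peel₂ peel₃

    private
      start : ∀ {X Y : Rel (Fin n) 0ℓ} (κ : C11Colouring X Y) {T : Rel (Fin n) 0ℓ} →
        (∀ {x y} → x < y → Concordant X Y x y → T x y) →
        ∀ {R : Fin n → Bool} {e} → C11Colouring.colour κ e ≡ false → (∀ p → R p ≡ true → p ≢ e → Y p e) →
        ∀ x y → x < y → R x ≡ true → R y ≡ true → x ≢ e → y ≢ e →
        ¬ (Y x e × X e x) → ¬ (Y y e × X e y) → T x y
      start {X} {Y} κ trend {R} {e} ce R-Y-e x y x<y Rx Ry x≢e y≢e ¬bx ¬by =
        trend x<y (concordant-with-false⇒concordant ce (concordant x Rx x≢e ¬bx) (concordant y Ry y≢e ¬by) (Fin.<⇒≢ x<y))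
        where
        open C11Colouring-properties κ
        concordant : ∀ z → R z ≡ true → z ≢ e → ¬ (Y z e × X e z) → Concordant X Y z e
        concordant z Rz z≢e ¬bz =
          concordant-if-not-X-above z≢e (λ Xez → ¬bz (R-Y-e z Rz z≢e , Xez)) (R-Y-e z Rz z≢e)

    start₂ : ∀ {R e} → proj₁ c11 e ≡ false → R e ≡ true → (∀ p → R p ≡ true → p ≢ e → Below p e) → Start 2 R e
    start₂ {R} {e} ce Re below = Re , below , start frame₂ trend {R} {e} ce below
      where
      trend : ∀ {x y} → x < y → Concordant LeftOf Below x y → Below x y
      trend _   (inj₁ (_ , b)) = b
      trend x<y (inj₂ (y<x , _)) = ⊥-elim (Fin.<-asym x<y y<x)

    start₃ : ∀ {R e} → proj₁ c11 e ≡ true → R e ≡ true → (∀ p → R p ≡ true → p ≢ e → RightOf p e) → Start 3 R e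
    start₃ {R} {e} ce Re right = Re , right , start frame₃ trend {R} {e} (cong not ce) right
      where
      trend : ∀ {x y} → x < y → Concordant Below RightOf x y → Above x y
      trend x<y (inj₁ (_ , y<x)) = ⊥-elim (Fin.<-asym x<y y<x)
      trend _   (inj₂ (a , _)) = a

    start₀ : ∀ {R e} → proj₁ c11 e ≡ false → R e ≡ true → (∀ p → R p ≡ true → p ≢ e → Above p e) → Start 0 R e
    start₀ {R} {e} ce Re above = Re , above , start frame₀ trend {R} {e} (cong not (cong not ce)) above
      where
      trend : ∀ {x y} → x < y → Concordant RightOf Above x y → Below x y
      trend x<y (inj₁ (y<x , _)) = ⊥-elim (Fin.<-asym x<y y<x)
      trend _   (inj₂ (_ , b)) = b

    start₁ : ∀ {R e} → proj₁ c11 e ≡ true → R e ≡ true → (∀ p → R p ≡ true → p ≢ e → LeftOf p e) → Start 1 R e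
    start₁ {R} {e} ce Re left = Re , left , start frame₁ trend {R} {e} (cong not (cong not (cong not ce))) left
      where
      trend : ∀ {x y} → x < y → Concordant Above LeftOf x y → Above x y
      trend _   (inj₁ (a , _)) = a
      trend x<y (inj₂ (_ , y<x)) = ⊥-elim (Fin.<-asym x<y y<x)

module _ {n : ℕ} where

  ⟦_⟧ᵇ : (Fin n → Bool) → Fin n → Set
  ⟦ R ⟧ᵇ p = R p ≡ true

  _⊆ᵇ_ : (Fin n → Bool) → (Fin n → Bool) → Set
  S ⊆ᵇ R = ∀ p → S p ≡ true → R p ≡ true

  count : (Fin n → Bool) → List (Fin n) → ℕ
  count R []       = 0
  count R (p ∷ ps) = (if R p then 1 else 0) + count R ps

  size : (Fin n → Bool) → ℕ
  size R = count R (allFin n)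

  private
    indicator-mono : ∀ {a b} → (a ≡ true → b ≡ true) → (if a then 1 else 0) ≤ (if b then 1 else 0)
    indicator-mono {false}         _   = z≤n
    indicator-mono {true}  {true}  _   = s≤s z≤n
    indicator-mono {true}  {false} a⇒b with a⇒b refl
    ... | ()

    count-mono : ∀ {S R} → S ⊆ᵇ R → ∀ ps → count S ps ≤ count R ps
    count-mono S⊆R []       = z≤n
    count-mono S⊆R (p ∷ ps) = ℕ.+-mono-≤ (indicator-mono (S⊆R p)) (count-mono S⊆R ps)

    count-mono-< : ∀ {S R p ps} → S ⊆ᵇ R → p ∈ ps → R p ≡ true → S p ≡ false → count S ps ℕ.< count R ps
    count-mono-< {ps = _ ∷ ps} S⊆R (here refl) Rp Sp rewrite Rp | Sp = s≤s (count-mono S⊆R ps)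
    count-mono-< {ps = q ∷ _}  S⊆R (there p∈) Rp Sp =
      ℕ.+-mono-≤-< (indicator-mono (S⊆R q)) (count-mono-< S⊆R p∈ Rp Sp)

  size-shrinks : ∀ {S R p f} → S ⊆ᵇ R → R p ≡ true → S p ≡ false → size R ≤ suc f → size S ≤ f
  size-shrinks S⊆R Rp Sp size≤ = ℕ.≤-pred (ℕ.≤-trans (count-mono-< S⊆R (∈-allFin _) Rp Sp) size≤)

  size≤0⇒empty : ∀ {R} → size R ≤ 0 → ∀ p → R p ≢ true
  size≤0⇒empty {R} size≤0 p Rp with ℕ.≤-trans (count-mono-< {S = λ _ → false} (λ _ ()) (∈-allFin p) Rp refl) size≤0
  ... | ()

  private
    members : (Fin n → Bool) → List (Fin n)
    members R = filter (λ p → R p ≟ true) (allFin n)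

    ∈-members : ∀ {R p} → R p ≡ true → p ∈ members R
    ∈-members Rp = ∈-filter⁺ (λ p → _ ≟ true) (∈-allFin _) Rp

  maximum : ∀ (key : Fin n → ℕ) R {p₀} → R p₀ ≡ true →
    ∃ λ e → R e ≡ true × ∀ p → R p ≡ true → key p ≤ key e
  maximum key R {p₀} Rp₀ =
    e , argmax-all key {P = λ p → R p ≡ true} Rp₀ (all-filter (λ p → R p ≟ true) (allFin n)) ,
    λ p Rp → All.lookup (f[xs]≤f[argmax] p₀ (members R)) (∈-members Rp)
    where
    e : Fin n
    e = argmax key p₀ (members R)

  minimum : ∀ (key : Fin n → ℕ) R {p₀} → R p₀ ≡ true →
    ∃ λ e → R e ≡ true × ∀ p → R p ≡ true → key e ≤ key p
  minimum key R {p₀} Rp₀ =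
    e , argmin-all key {P = λ p → R p ≡ true} Rp₀ (all-filter (λ p → R p ≟ true) (allFin n)) ,
    λ p Rp → All.lookup (f[argmin]≤f[xs] p₀ (members R)) (∈-members Rp)
    where
    e : Fin n
    e = argmin key p₀ (members R)

  ∅ᵇ : Fin n → Bool
  ∅ᵇ _ = false

  _∖ᵇ_ : (Fin n → Bool) → (Fin n → Bool) → Fin n → Bool
  (R ∖ᵇ F) p = R p ∧ not (F p)

  ∖ᵇ-intro : ∀ R F {p} → R p ≡ true → F p ≡ false → (R ∖ᵇ F) p ≡ true
  ∖ᵇ-intro R F Rp Fp rewrite Rp | Fp = refl

  ∖ᵇ-elim : ∀ R F {p} → (R ∖ᵇ F) p ≡ true → R p ≡ true × F p ≡ false
  ∖ᵇ-elim R F {p} e with R p | F p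
  ∖ᵇ-elim R F {p} e  | true  | false = refl , refl
  ∖ᵇ-elim R F {p} () | true  | true
  ∖ᵇ-elim R F {p} () | false | _

  ∖ᵇ-⊆ᵇ : ∀ R F → (R ∖ᵇ F) ⊆ᵇ R
  ∖ᵇ-⊆ᵇ R F p e = proj₁ (∖ᵇ-elim R F e)

  ∖ᵇ-removes : ∀ R F {p} → F p ≡ true → (R ∖ᵇ F) p ≡ false
  ∖ᵇ-removes R F {p} Fp rewrite Fp with R p
  ... | true  = refl
  ... | false = refl

  ｛_｝ᵇ : Fin n → Fin n → Bool
  ｛ e ｝ᵇ p = does (p Fin.≟ e)

  ∈｛｝ᵇ : ∀ e → ｛ e ｝ᵇ e ≡ true
  ∈｛｝ᵇ e with e Fin.≟ e
  ... | yes _  = refl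
  ... | no e≢e = ⊥-elim (e≢e refl)

  ∈｛｝ᵇ⇒≡ : ∀ e p → ｛ e ｝ᵇ p ≡ true → p ≡ e
  ∈｛｝ᵇ⇒≡ e p h with p Fin.≟ e
  ∈｛｝ᵇ⇒≡ e p h  | yes p≡e = p≡e
  ∈｛｝ᵇ⇒≡ e p () | no _

  ∉｛｝ᵇ⇒≢ : ∀ e p → ｛ e ｝ᵇ p ≡ false → p ≢ e
  ∉｛｝ᵇ⇒≢ e p h refl with trans (sym (∈｛｝ᵇ e)) h
  ... | ()

  assign : (Fin n → Bool) → ℕ → (Fin n → ℕ) → Fin n → ℕ
  assign F i blk p = if F p then i else blk p

  assign-∈ : ∀ F i blk {p} → F p ≡ true → assign F i blk p ≡ i
  assign-∈ F i blk Fp rewrite Fp = refl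

  assign-∉ : ∀ F i blk {p} → F p ≡ false → assign F i blk p ≡ blk p
  assign-∉ F i blk Fp rewrite Fp = refl

module PartialSpirals {n : ℕ} (π : Permutation′ n) where
  open Geometry π

  ConditionB : (Fin n → ℕ) → ℕ → Fin n → Fin n → Set
  ConditionB blk i q p = (blk p ≡ i → Adjacent (i % 4) q p) × (suc i ≤ blk p → Beyond (i % 4) q p)

  -- Blocks B_i, …, B_m decomposing R and continuing a block B_{i-1} = L.
  record PartialSpiral (i : ℕ) (R L : Fin n → Bool) : Set where
    field
      m : ℕ
      blk : Fin n → ℕ
      i≤1+m : i ≤ suc m
      in-range : ∀ p → R p ≡ true → i ≤ blk p × blk p ≤ m
      within-block : ∀ p q → p < q → R p ≡ true → R q ≡ true → blk p ≡ blk q → Trend (blk p % 2) p q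
      between-blocks : ∀ q p → R q ≡ true → R p ≡ true → blk q ℕ.< blk p → ConditionB blk (suc (blk q)) q p
      after-L : ∀ q p → L q ≡ true → R p ≡ true → ConditionB blk i q p
      no-gap : ∀ j → i ≤ j → j + 3 ≤ m → ∃ λ p → R p ≡ true × j ≤ blk p × blk p ≤ j + 3

  empty : ∀ i {R L} → (∀ p → R p ≢ true) → PartialSpiral i R L
  empty i {R} {L} R-empty = record
    { m = i ∸ 1
    ; blk = λ _ → 0
    ; i≤1+m = ℕ.m≤n+m∸n i 1
    ; in-range = λ p Rp → ⊥-elim (R-empty p Rp)
    ; within-block = λ p _ _ Rp _ _ → ⊥-elim (R-empty p Rp)
    ; between-blocks = λ q _ Rq _ _ → ⊥-elim (R-empty q Rq)
    ; after-L = λ _ p _ Rp → ⊥-elim (R-empty p Rp)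
    ; no-gap = λ j i≤j j+3≤m →
        ⊥-elim (ℕ.m+1+n≰m j (ℕ.≤-trans j+3≤m (ℕ.≤-trans (ℕ.m∸n≤m i 1) i≤j))) }

  prependBlock : ∀ i {R L} F → F ⊆ᵇ R →
    (∀ q p → L q ≡ true → F p ≡ true → Adjacent (i % 4) q p) →
    (∀ q p → L q ≡ true → R p ≡ true → F p ≡ false → Beyond (i % 4) q p) →
    (∀ x y → x < y → F x ≡ true → F y ≡ true → Trend (i % 2) x y) →
    ∃ (λ p → F p ≡ true) →
    PartialSpiral (suc i) (R ∖ᵇ F) F →
    Σ (PartialSpiral i R L) λ S → ∀ p → F p ≡ true → PartialSpiral.blk S p ≡ i
  prependBlock i {R} {L} F F⊆R L-adjacent-F L-beyond-rest F-trend (p₀ , Fp₀) rest =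
    record
      { m = m ; blk = B ; i≤1+m = ℕ.m≤n⇒m≤1+n i≤m ; in-range = in-range′
      ; within-block = within-block′ ; between-blocks = between-blocks′
      ; after-L = after-L′ ; no-gap = no-gap′ } ,
    λ p Fp → assign-∈ F i blk Fp
    where
    open PartialSpiral rest
    B : Fin n → ℕ
    B = assign F i blk
    ∈rest : ∀ {p} → R p ≡ true → F p ≡ false → (R ∖ᵇ F) p ≡ true
    ∈rest = ∖ᵇ-intro R F
    i≤m : i ≤ m
    i≤m = ℕ.≤-pred i≤1+m
    rest-above : ∀ {p} → R p ≡ true → F p ≡ false → suc i ≤ blk p
    rest-above Rp Fp = proj₁ (in-range _ (∈rest Rp Fp))

    in-range′ : ∀ p → R p ≡ true → i ≤ B p × B p ≤ m
    in-range′ p Rp with F p in Fp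
    ... | true  = ℕ.≤-refl , i≤m
    ... | false = ℕ.<⇒≤ (rest-above Rp Fp) , proj₂ (in-range p (∈rest Rp Fp))

    within-block′ : ∀ p q → p < q → R p ≡ true → R q ≡ true → B p ≡ B q → Trend (B p % 2) p q
    within-block′ p q p<q Rp Rq same with F p in Fp | F q in Fq
    ... | true  | true  = F-trend p q p<q Fp Fq
    ... | false | false = within-block p q p<q (∈rest Rp Fp) (∈rest Rq Fq) same
    ... | true  | false = ⊥-elim (ℕ.<⇒≢ (rest-above Rq Fq) same)
    ... | false | true  = ⊥-elim (ℕ.<⇒≢ (rest-above Rp Fp) (sym same))

    between-blocks′ : ∀ q p → R q ≡ true → R p ≡ true → B q ℕ.< B p → ConditionB B (suc (B q)) q p
    between-blocks′ q p Rq Rp q<p with F q in Fq | F p in Fp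
    ... | true  | false = after-L q p Fq (∈rest Rp Fp)
    ... | true  | true  = ⊥-elim (ℕ.<-irrefl refl q<p)
    ... | false | true  = ⊥-elim (ℕ.<-asym q<p (rest-above Rq Fq))
    ... | false | false = between-blocks q p (∈rest Rq Fq) (∈rest Rp Fp) q<p

    after-L′ : ∀ q p → L q ≡ true → R p ≡ true → ConditionB B i q p
    after-L′ q p Lq Rp with F p in Fp
    ... | true  = (λ _ → L-adjacent-F q p Lq Fp) , (λ i<i → ⊥-elim (ℕ.<-irrefl refl i<i))
    ... | false = (λ blk≡i → ⊥-elim (ℕ.<⇒≢ (rest-above Rp Fp) (sym blk≡i))) , (λ _ → L-beyond-rest q p Lq Rp Fp)

    no-gap′ : ∀ j → i ≤ j → j + 3 ≤ m → ∃ λ p → R p ≡ true × j ≤ B p × B p ≤ j + 3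
    no-gap′ j i≤j j+3≤m with ℕ.m≤n⇒m<n∨m≡n i≤j
    ... | inj₂ refl = p₀ , F⊆R p₀ Fp₀ , subst (λ b → i ≤ b × b ≤ i + 3) (sym (assign-∈ F i blk Fp₀)) (ℕ.≤-refl , ℕ.m≤m+n i 3)
    ... | inj₁ i<j with no-gap j i<j j+3≤m
    ...   | p , R∖Fp , j≤ , ≤j+3 with ∖ᵇ-elim R F R∖Fp
    ...     | Rp , Fp = p , Rp , subst (λ b → j ≤ b × b ≤ j + 3) (sym (assign-∉ F i blk Fp)) (j≤ , ≤j+3)

  prependEmptyBlocks : ∀ i s {R L} (S : PartialSpiral s R ∅ᵇ) → i ≤ s → s ≤ i + 3 →
    (∀ q p → L q ≡ true → R p ≡ true → Beyond (i % 4) q p) →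
    (∃ λ p → R p ≡ true × PartialSpiral.blk S p ≡ s) → PartialSpiral i R L
  prependEmptyBlocks i s {R} {L} S i≤s s≤i+3 L-beyond-R (e , Re , blk-e) = record
    { m = m ; blk = blk ; i≤1+m = ℕ.≤-trans i≤s i≤1+m
    ; in-range = λ p Rp → ℕ.≤-trans i≤s (proj₁ (in-range p Rp)) , proj₂ (in-range p Rp)
    ; within-block = within-block ; between-blocks = between-blocks
    ; after-L = λ q p Lq Rp → (λ _ → beyond⇒adjacent (i % 4) (L-beyond-R q p Lq Rp)) , (λ _ → L-beyond-R q p Lq Rp)
    ; no-gap = no-gap′ }
    where
    open PartialSpiral S
    no-gap′ : ∀ j → i ≤ j → j + 3 ≤ m → ∃ λ p → R p ≡ true × j ≤ blk p × blk p ≤ j + 3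
    no-gap′ j i≤j j+3≤m with ℕ.≤-total s j
    ... | inj₁ s≤j = no-gap j s≤j j+3≤m
    ... | inj₂ j≤s = e , Re , subst (λ b → j ≤ b × b ≤ j + 3) (sym blk-e)
                                    (j≤s , ℕ.≤-trans s≤i+3 (ℕ.+-monoˡ-≤ 3 i≤j))

StrictlyIncreasing : ∀ {k n} → (Fin k → Fin n) → Set
StrictlyIncreasing f = ∀ i j → i < j → f i < f j

increasing-reflects-< : ∀ {k n} {h : Fin k → Fin n} → StrictlyIncreasing h → ∀ {a b} → h a < h b → a < b
increasing-reflects-< {h = h} h↑ {a} {b} ha<hb with Fin.<-cmp a b
... | tri< a<b _ _ = a<b
... | tri≈ _ refl _ = ⊥-elim (Fin.<-irrefl refl ha<hb)
... | tri> _ _ b<a = ⊥-elim (Fin.<-asym ha<hb (h↑ b a b<a))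

increasing-image⇒contains : ∀ {n k} (τ : Permutation′ n) (σ : Permutation′ k) (f h : Fin k → Fin n) →
  StrictlyIncreasing f → StrictlyIncreasing h → (∀ i → τ ⟨$⟩ʳ f i ≡ h (σ ⟨$⟩ʳ i)) → Contains τ σ
increasing-image⇒contains τ σ f h f↑ h↑ τf≡hσ = f , f↑ , λ i j → mk⇔
  (λ σi<σj → subst₂ _<_ (sym (τf≡hσ i)) (sym (τf≡hσ j)) (h↑ _ _ σi<σj))
  (λ τfi<τfj → increasing-reflects-< h↑ (subst₂ _<_ (τf≡hσ i) (τf≡hσ j) τfi<τfj))

quad : ∀ {A : Set} → A → A → A → A → Fin 4 → A
quad a b c d 0F = a
quad a b c d 1F = b
quad a b c d 2F = c
quad a b c d 3F = d

quad-increasing : ∀ {n} {a b c d : Fin n} → a < b → b < c → c < d → StrictlyIncreasing (quad a b c d)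
quad-increasing a<b b<c c<d = λ where
  0F 1F _ → a<b
  0F 2F _ → ℕ.<-trans a<b b<c
  0F 3F _ → ℕ.<-trans a<b (ℕ.<-trans b<c c<d)
  1F 2F _ → b<c
  1F 3F _ → ℕ.<-trans b<c c<d
  2F 3F _ → c<d
  0F 0F ()
  1F 0F ()
  2F 0F ()
  3F 0F ()
  1F 1F (s≤s ())
  2F 1F (s≤s ())
  3F 1F (s≤s ())
  2F 2F (s≤s (s≤s ()))
  3F 2F (s≤s (s≤s ()))
  3F 3F (s≤s (s≤s (s≤s ())))

contains-3142 : ∀ {n} (τ : Permutation′ n) {f m M g : Fin n} → f < m → m < M → M < g →
  τ ⟨$⟩ʳ m < τ ⟨$⟩ʳ g → τ ⟨$⟩ʳ g < τ ⟨$⟩ʳ f → τ ⟨$⟩ʳ f < τ ⟨$⟩ʳ M → Contains τ p3142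
contains-3142 τ f<m m<M M<g vm<vg vg<vf vf<vM =
  increasing-image⇒contains τ p3142 _ _ (quad-increasing f<m m<M M<g) (quad-increasing vm<vg vg<vf vf<vM)
    λ { 0F → refl ; 1F → refl ; 2F → refl ; 3F → refl }

offset-to-residue : ∀ i r → r ℕ.< 4 → ∃ λ d → d ≤ 3 × (i + d) % 4 ≡ r
offset-to-residue zero r r<4 = r , ℕ.≤-pred r<4 , m<n⇒m%n≡m r<4
offset-to-residue (suc i) r r<4 with offset-to-residue i r r<4
... | suc d , d≤3 , i+d≡r = d , ℕ.≤-trans (ℕ.n≤1+n d) d≤3 , trans (cong (_% 4) (sym (ℕ.+-suc i d))) i+d≡r
... | zero  , _   , i+0≡r = 3 , ℕ.≤-refl , (begin
  (suc i + 3) % 4 ≡⟨ cong (_% 4) (sym (ℕ.+-suc i 3)) ⟩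
  (i + 4) % 4       ≡⟨ [m+n]%n≡m%n i 4 ⟩
  i % 4             ≡⟨ cong (_% 4) (sym (ℕ.+-identityʳ i)) ⟩
  (i + 0) % 4       ≡⟨ i+0≡r ⟩
  r                 ∎)
  where open ≡-Reasoning

module Construction {n : ℕ} (π : Permutation′ n) (c11 : C11 π) (av : Av3142 π) where
  open Geometry π
  open Coloured c11
  open PartialSpirals π

  private
    colour : Fin n → Bool
    colour = proj₁ c11

    position-extreme : ∀ {p e : Fin n} → toℕ p ≤ toℕ e → p ≢ e → p < e
    position-extreme = Fin.≤∧≢⇒<

    value-extreme : ∀ {p e : Fin n} → toℕ (value p) ≤ toℕ (value e) → p ≢ e → Below p e
    value-extreme v≤ p≢e = Fin.≤∧≢⇒< v≤ (p≢e ∘ value-injective)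

    colours-differ : ∀ {a b : Fin n} → colour a ≡ false → colour b ≡ true → a ≢ b
    colours-differ ca cb refl with trans (sym ca) cb
    ... | ()

  extremes-3142 : ∀ {R : Fin n → Bool} {top left bottom right : Fin n} →
    R top ≡ true → R left ≡ true → R bottom ≡ true → R right ≡ true →
    (∀ p → R p ≡ true → toℕ (value p) ≤ toℕ (value top)) → (∀ p → R p ≡ true → toℕ left ≤ toℕ p) →
    (∀ p → R p ≡ true → toℕ (value bottom) ≤ toℕ (value p)) → (∀ p → R p ≡ true → toℕ p ≤ toℕ right) →
    colour top ≡ true → colour left ≡ false → colour bottom ≡ true → colour right ≡ false → ⊥
  extremes-3142 {R} {top} {left} {bottom} {right} Rt Rl Rb Rr ≤top left≤ bottom≤ ≤right ct cl cb cr =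
    av (contains-3142 π left<bottom bottom<top top<right
          (value-extreme (bottom≤ right Rr) (colours-differ cr cb ∘ sym))
          (proj₂ (proj₂ c11) left right left<right cl cr)
          (value-extreme (≤top left Rl) (colours-differ cl ct)))
    where
    left<bottom : left < bottom
    left<bottom = position-extreme (left≤ bottom Rb) (colours-differ cl cb)
    bottom≢top : bottom ≢ top
    bottom≢top refl = colours-differ cl ct (value-injective (Fin.≤-antisym (≤top left Rl) (bottom≤ left Rl)))
    bottom<top : bottom < top
    bottom<top with Fin.<-cmp bottom top
    ... | tri< b<t _ _ = b<t
    ... | tri≈ _ b≡t _ = ⊥-elim (bottom≢top b≡t)
    ... | tri> _ _ t<b = ⊥-elim (ℕ.<⇒≱ (proj₁ (proj₂ c11) top bottom t<b ct cb) (bottom≤ top Rt))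
    top<right : top < right
    top<right = position-extreme (≤right top Rt) (colours-differ cr ct ∘ sym)
    left<right : left < right
    left<right = ℕ.<-trans left<bottom (ℕ.<-trans bottom<top top<right)

  choose-start : ∀ R {p₀} → R p₀ ≡ true → ∃₂ λ r e → r ℕ.< 4 × Start r R e
  choose-start R Rp₀
    with maximum (toℕ ∘ value) R Rp₀ | minimum toℕ R Rp₀ | minimum (toℕ ∘ value) R Rp₀ | maximum toℕ R Rp₀
  ... | top , Rt , ≤top | left , Rl , left≤ | bottom , Rb , bottom≤ | right , Rr , ≤right
    with colour top in ct | colour left in cl | colour bottom in cb | colour right in cr
  ... | false | _     | _     | _     =
    2 , top , ℕ.s<s (ℕ.s<s ℕ.z<s) ,
    start₂ ct Rt λ p Rp p≢top → value-extreme (≤top p Rp) p≢top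
  ... | true  | true  | _     | _     =
    3 , left , ℕ.s<s (ℕ.s<s (ℕ.s<s ℕ.z<s)) ,
    start₃ cl Rl λ p Rp p≢left → position-extreme (left≤ p Rp) (p≢left ∘ sym)
  ... | true  | false | false | _     =
    0 , bottom , ℕ.z<s ,
    start₀ cb Rb λ p Rp p≢bottom → value-extreme (bottom≤ p Rp) (p≢bottom ∘ sym)
  ... | true  | false | true  | true  =
    1 , right , ℕ.s<s ℕ.z<s ,
    start₁ cr Rr λ p Rp p≢right → position-extreme (≤right p Rp) p≢right
  ... | true  | false | true  | false =
    ⊥-elim (extremes-3142 Rt Rl Rb Rr ≤top left≤ bottom≤ ≤right ct cl cb cr)

  Adjacency InnerMonotone : ℕ → (Fin n → Bool) → (Fin n → Bool) → Set
  Adjacency i R L = ∀ q p → L q ≡ true → R p ≡ true → Adjacent (i % 4) q p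
  InnerMonotone i R L = ∀ x y → x < y →
    Inner (i % 4) ⟦ R ⟧ᵇ ⟦ L ⟧ᵇ x → Inner (i % 4) ⟦ R ⟧ᵇ ⟦ L ⟧ᵇ y → Trend (i % 2) x y

  not-beyond-some? : ∀ i (L : Fin n → Bool) p → Dec (∃ λ l → L l ≡ true × ¬ Beyond (i % 4) l p)
  not-beyond-some? i L p = Fin.any? λ l → (L l ≟ true) ×-dec ¬? (beyond? (i % 4) l p)

  innerᵇ : ℕ → (Fin n → Bool) → (Fin n → Bool) → Fin n → Bool
  innerᵇ i R L p = R p ∧ does (not-beyond-some? i L p)

  innerᵇ-sound : ∀ i R L {p} → innerᵇ i R L p ≡ true → Inner (i % 4) ⟦ R ⟧ᵇ ⟦ L ⟧ᵇ p
  innerᵇ-sound i R L {p} h with R p | not-beyond-some? i L p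
  ... | true  | yes (l , Ll , ¬beyond) = refl , l , Ll , ¬beyond
  innerᵇ-sound i R L {p} () | true  | no _
  innerᵇ-sound i R L {p} () | false | _

  not-innerᵇ⇒beyond : ∀ i R L {p} → R p ≡ true → innerᵇ i R L p ≡ false →
    ∀ l → L l ≡ true → Beyond (i % 4) l p
  not-innerᵇ⇒beyond i R L {p} Rp h l Ll
    with R p | not-beyond-some? i L p
  ... | true  | no none with beyond? (i % 4) l p
  ...   | yes beyond = beyond
  ...   | no ¬beyond = ⊥-elim (none (l , Ll , ¬beyond))
  not-innerᵇ⇒beyond i R L {p} Rp () l Ll | true  | yes _
  not-innerᵇ⇒beyond i R L {p} () h  l Ll | false | _

  Recursion : ℕ → Set
  Recursion f = ∀ i R L → size R ≤ f → Adjacency i R L → InnerMonotone i R L → PartialSpiral i R L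

  -- When all of R lies beyond L, block i may be chosen freely: {e} becomes the block
  -- s ∈ [i, i + 3] whose successor has the residue required by Start, and the
  -- blocks i, …, s - 1 stay empty.
  restartAt : ∀ f → Recursion f → ∀ i R L → size R ≤ suc f →
    (∀ q p → L q ≡ true → R p ≡ true → Beyond (i % 4) q p) →
    ∀ {r e} → r ℕ.< 4 → Start r R e → PartialSpiral i R L
  restartAt f recurse i R L size≤ L-beyond-R {e = e} r<4 (Re , adjacent , monotone)
    with offset-to-residue (suc i) _ r<4
  ... | d , d≤3 , refl =
    prependEmptyBlocks i s (proj₁ S) (ℕ.m≤m+n i d) (ℕ.+-monoʳ-≤ i d≤3) L-beyond-R (e , Re , proj₂ S e (∈｛｝ᵇ e))
    where
    s : ℕ
    s = i + d
    E : Fin n → Bool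
    E = ｛ e ｝ᵇ
    parity : (suc s % 4) % 2 ≡ suc s % 2
    parity = m∣n⇒o%n%m≡o%m 2 4 (suc s) (divides 2 refl)
    adjacent′ : Adjacency (suc s) (R ∖ᵇ E) E
    adjacent′ q p Eq R∖Ep with ∈｛｝ᵇ⇒≡ e q Eq | ∖ᵇ-elim R E R∖Ep
    ... | refl | Rp , Ep = adjacent p Rp (∉｛｝ᵇ⇒≢ e p Ep)
    monotone′ : InnerMonotone (suc s) (R ∖ᵇ E) E
    monotone′ x y x<y (R∖Ex , l , El , ¬bx) (R∖Ey , l′ , El′ , ¬by)
      with ∈｛｝ᵇ⇒≡ e l El | ∈｛｝ᵇ⇒≡ e l′ El′ | ∖ᵇ-elim R E R∖Ex | ∖ᵇ-elim R E R∖Ey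
    ... | refl | refl | Rx , Ex | Ry , Ey = subst (λ b → Trend b x y) parity
      (monotone x y x<y Rx Ry (∉｛｝ᵇ⇒≢ e x Ex) (∉｛｝ᵇ⇒≢ e y Ey) ¬bx ¬by)
    S : Σ (PartialSpiral s R ∅ᵇ) λ S → ∀ p → E p ≡ true → PartialSpiral.blk S p ≡ s
    S = prependBlock s {R} {∅ᵇ} E (λ p Ep → subst (λ z → R z ≡ true) (sym (∈｛｝ᵇ⇒≡ e p Ep)) Re)
          (λ _ _ ()) (λ _ _ ())
          (λ x y x<y Ex Ey → ⊥-elim (Fin.<⇒≢ x<y (trans (∈｛｝ᵇ⇒≡ e x Ex) (sym (∈｛｝ᵇ⇒≡ e y Ey)))))
          (e , ∈｛｝ᵇ e)
          (recurse (suc s) (R ∖ᵇ E) E (size-shrinks (∖ᵇ-⊆ᵇ R E) Re (∖ᵇ-removes R E (∈｛｝ᵇ e)) size≤)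
             adjacent′ monotone′)

  restart : ∀ f → Recursion f → ∀ i R L → size R ≤ suc f →
    (∀ q p → L q ≡ true → R p ≡ true → Beyond (i % 4) q p) → PartialSpiral i R L
  restart f recurse i R L size≤ L-beyond-R with Fin.any? (λ p → R p ≟ true)
  ... | no R-empty = empty i λ p Rp → R-empty (p , Rp)
  ... | yes (p₀ , Rp₀) with choose-start R Rp₀
  ...   | r , e , r<4 , start = restartAt f recurse i R L size≤ L-beyond-R r<4 start

  build : ∀ f → Recursion f
  build zero i R L size≤0 _ _ = empty i (size≤0⇒empty size≤0)
  build (suc f) i R L size≤ adjacent monotone with Fin.any? (λ p → innerᵇ i R L p ≟ true)
  ... | no no-inner =
    restart f (build f) i R L size≤ λ q p Lq Rp →
      not-innerᵇ⇒beyond i R L Rp (¬-not (λ Fp → no-inner (p , Fp))) q Lq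
  ... | yes (p₀ , Fp₀) =
    proj₁ (prependBlock i F F⊆R (λ q p Lq Fp → adjacent q p Lq (F⊆R p Fp))
             (λ q p Lq Rp Fp → not-innerᵇ⇒beyond i R L Rp Fp q Lq)
             (λ x y x<y Fx Fy → monotone x y x<y (innerᵇ-sound i R L Fx) (innerᵇ-sound i R L Fy))
             (p₀ , Fp₀)
             (build f (suc i) (R ∖ᵇ F) F
               (size-shrinks (∖ᵇ-⊆ᵇ R F) (F⊆R p₀ Fp₀) (∖ᵇ-removes R F Fp₀) size≤) adjacent′ monotone′))
    where
    F : Fin n → Bool
    F = innerᵇ i R L
    F⊆R : F ⊆ᵇ R
    F⊆R p Fp = proj₁ (innerᵇ-sound i R L Fp)
    peeled : Peeled (i % 4) (suc i % 4) (suc i % 2) ⟦ R ⟧ᵇ ⟦ L ⟧ᵇ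
    peeled = peel i ⟦ R ⟧ᵇ ⟦ L ⟧ᵇ adjacent
    outer : ∀ {p} → (R ∖ᵇ F) p ≡ true → Outer (i % 4) ⟦ R ⟧ᵇ ⟦ L ⟧ᵇ p
    outer R∖Fp with ∖ᵇ-elim R F R∖Fp
    ... | Rp , Fp = Rp , λ l Ll → not-innerᵇ⇒beyond i R L Rp Fp l Ll
    adjacent′ : Adjacency (suc i) (R ∖ᵇ F) F
    adjacent′ q p Fq R∖Fp = proj₁ peeled q p (innerᵇ-sound i R L Fq) (outer R∖Fp)
    monotone′ : InnerMonotone (suc i) (R ∖ᵇ F) F
    monotone′ x y x<y (R∖Fx , l , Fl , ¬bx) (R∖Fy , l′ , Fl′ , ¬by) =
      proj₂ peeled x y x<y (outer R∖Fx , l , innerᵇ-sound i R L Fl , ¬bx)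
                           (outer R∖Fy , l′ , innerᵇ-sound i R L Fl′ , ¬by)

module SpiralConditions {n : ℕ} (π : Permutation′ n) (m : ℕ) (blk : Fin n → ℕ) where
  open Geometry π

  BlockTrend : ℕ → Set
  BlockTrend i = ∀ p q → p < q → blk p ≡ i → blk q ≡ i → Trend (i % 2) p q

  monotone⇔block-trend : ∀ i → Monotone π m blk i ⇔ BlockTrend i
  monotone⇔block-trend i with i % 2
  ... | 0           = mk⇔ (λ h → h) (λ h → h)
  ... | 1           = mk⇔ (λ h → h) (λ h → h)
  ... | suc (suc _) = mk⇔ (λ h → h) (λ h → h)

  BlockConditions : ℕ → ℕ → Set
  BlockConditions r i =
    (∀ p q → blk p ≡ i → blk q ≡ i ∸ 1 → Adjacent r q p) ×
    (∀ p q → suc i ≤ blk p → blk q ≡ i ∸ 1 → Beyond r q p)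

  condB⇔block-conditions : ∀ r i → CondB π m blk r i ⇔ BlockConditions r i
  condB⇔block-conditions 0 i = mk⇔
    (λ (a , b , c) → a , λ p q x y → b p q x y , c p q x y)
    (λ (a , h) → a , (λ p q x y → proj₁ (h p q x y)) , (λ p q x y → proj₂ (h p q x y)))
  condB⇔block-conditions 1 i = mk⇔
    (λ (a , b , c) → a , λ p q x y → c p q x y , b p q x y)
    (λ (a , h) → a , (λ p q x y → proj₂ (h p q x y)) , (λ p q x y → proj₁ (h p q x y)))
  condB⇔block-conditions 2 i = mk⇔
    (λ (a , b , c) → a , λ p q x y → b p q x y , c p q x y)
    (λ (a , h) → a , (λ p q x y → proj₁ (h p q x y)) , (λ p q x y → proj₂ (h p q x y)))
  condB⇔block-conditions (suc (suc (suc _))) i = mk⇔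
    (λ (a , b , c) → a , λ p q x y → c p q x y , b p q x y)
    (λ (a , h) → a , (λ p q x y → proj₂ (h p q x y)) , (λ p q x y → proj₁ (h p q x y)))

window-cases : ∀ j k → j ≤ k → k ≤ j + 3 → k ≡ j ⊎ k ≡ j + 1 ⊎ k ≡ j + 2 ⊎ k ≡ j + 3
window-cases zero 0 _ _ = inj₁ refl
window-cases zero 1 _ _ = inj₂ (inj₁ refl)
window-cases zero 2 _ _ = inj₂ (inj₂ (inj₁ refl))
window-cases zero 3 _ _ = inj₂ (inj₂ (inj₂ refl))
window-cases zero (suc (suc (suc (suc _)))) _ (s≤s (s≤s (s≤s ())))
window-cases (suc j) (suc k) (s≤s j≤k) (s≤s k≤j+3) with window-cases j k j≤k k≤j+3
... | inj₁ e = inj₁ (cong suc e)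
... | inj₂ (inj₁ e) = inj₂ (inj₁ (cong suc e))
... | inj₂ (inj₂ (inj₁ e)) = inj₂ (inj₂ (inj₁ (cong suc e)))
... | inj₂ (inj₂ (inj₂ e)) = inj₂ (inj₂ (inj₂ (cong suc e)))

module ToSpiral {n : ℕ} (π : Permutation′ n) (c11 : C11 π) (av : Av3142 π) where
  open Geometry π
  open PartialSpirals π
  open Construction π c11 av

  decomposition : PartialSpiral 1 (λ _ → true) ∅ᵇ
  decomposition = build (size {n} (λ _ → true)) 1 (λ _ → true) ∅ᵇ ℕ.≤-refl (λ _ _ ()) λ where
    _ _ _ (_ , _ , () , _) _

  open PartialSpiral decomposition public using (m; blk)
  open PartialSpiral decomposition using (in-range; within-block; between-blocks; no-gap)
  open SpiralConditions π m blk

  condition : ∀ i → 2 ≤ i → ∀ q p → blk q ≡ i ∸ 1 → i ≤ blk p → ConditionB blk i q p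
  condition i 2≤i q p bq i≤bp =
    subst (λ j → ConditionB blk j q p) successor (between-blocks q p refl refl (subst (_≤ blk p) (sym successor) i≤bp))
    where
    successor : suc (blk q) ≡ i
    successor = trans (cong suc bq) (ℕ.m+[n∸m]≡n (ℕ.≤-trans (s≤s z≤n) 2≤i))

  isSpiral : IsSpiralDecomposition π m blk
  isSpiral = record
    { inRange = λ p → in-range p refl
    ; blocksMon = λ i _ _ → Equivalence.from (monotone⇔block-trend i) λ p q p<q bp bq →
        subst (λ j → Trend (j % 2) p q) bp (within-block p q p<q refl refl (trans bp (sym bq)))
    ; blocksPos = λ i 2≤i _ → Equivalence.from (condB⇔block-conditions (i % 4) i)
        ( (λ p q bp bq → proj₁ (condition i 2≤i q p bq (ℕ.≤-reflexive (sym bp))) bp)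
        , (λ p q i<bp bq → proj₂ (condition i 2≤i q p bq (ℕ.<⇒≤ i<bp)) i<bp)) }

  noFour : NoFourConsecutiveEmpty π m blk
  noFour j 1≤j j+3≤m (e₀ , e₁ , e₂ , e₃) with no-gap j 1≤j j+3≤m
  ... | p , _ , j≤bp , bp≤j+3 with window-cases j (blk p) j≤bp bp≤j+3
  ...   | inj₁ e               = e₀ p e
  ...   | inj₂ (inj₁ e)        = e₁ p e
  ...   | inj₂ (inj₂ (inj₁ e)) = e₂ p e
  ...   | inj₂ (inj₂ (inj₂ e)) = e₃ p e

%2-cases : ∀ a → a % 2 ≡ 0 ⊎ a % 2 ≡ 1
%2-cases 0 = inj₁ refl
%2-cases 1 = inj₂ refl
%2-cases (suc (suc a)) = %2-cases a

suc-%2-≢ : ∀ a → suc a % 2 ≢ a % 2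
suc-%2-≢ 0 ()
suc-%2-≢ 1 ()
suc-%2-≢ (suc (suc a)) = suc-%2-≢ a

residue-cases : ∀ a →
  (a % 2 ≡ 0 × suc a % 2 ≡ 1 × (suc a % 4 ≡ 1 ⊎ suc a % 4 ≡ 3)) ⊎
  (a % 2 ≡ 1 × suc a % 2 ≡ 0 × (suc a % 4 ≡ 0 ⊎ suc a % 4 ≡ 2))
residue-cases 0 = inj₁ (refl , refl , inj₁ refl)
residue-cases 1 = inj₂ (refl , refl , inj₂ refl)
residue-cases 2 = inj₁ (refl , refl , inj₂ refl)
residue-cases 3 = inj₂ (refl , refl , inj₁ refl)
residue-cases (suc (suc (suc (suc a)))) = residue-cases a

module FromSpiral {n : ℕ} (π : Permutation′ n) (m : ℕ) (blk : Fin n → ℕ) (S : IsSpiralDecomposition π m blk) where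
  open Geometry π
  open PartialSpirals π using (ConditionB)
  open SpiralConditions π m blk
  open IsSpiralDecomposition S

  later-block : ∀ x y → blk x ℕ.< blk y → ConditionB blk (suc (blk x)) x y
  later-block x y bx<by with Equivalence.to (condB⇔block-conditions (suc (blk x) % 4) (suc (blk x)))
    (blocksPos (suc (blk x)) (s≤s (proj₁ (inRange x))) (ℕ.≤-trans bx<by (proj₂ (inRange y))))
  ... | adjacent , beyond = (λ e → adjacent y x e refl) , (λ le → beyond y x le refl)

  same-block : ∀ x y → x < y → blk x ≡ blk y → Trend (blk x % 2) x y
  same-block x y x<y e = Equivalence.to (monotone⇔block-trend (blk x))
    (blocksMon (blk x) (proj₁ (inRange x)) (proj₂ (inRange x))) x y x<y refl (sym e)

  -- Blocks of equal parity are never consecutive.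
  far-block : ∀ x y → blk x ℕ.< blk y → blk x % 2 ≡ blk y % 2 → Beyond (suc (blk x) % 4) x y
  far-block x y bx<by same-parity with blk y ℕ.≟ suc (blk x)
  ... | yes e = ⊥-elim (suc-%2-≢ (blk x) (trans (sym (cong (_% 2) e)) (sym same-parity)))
  ... | no ne = proj₂ (later-block x y bx<by) (ℕ.≤∧≢⇒< bx<by (ne ∘ sym))

  same-parity-trend : ∀ x y → x < y → blk x % 2 ≡ blk y % 2 → Trend (blk x % 2) x y
  same-parity-trend x y x<y same-parity with ℕ.<-cmp (blk x) (blk y)
  ... | tri≈ _ e _ = same-block x y x<y e
  ... | tri< bx<by _ _ = beyond-forward (blk x) x<y (far-block x y bx<by same-parity)
  ... | tri> _ _ by<bx = subst (λ k → Trend k x y) (sym same-parity)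
                           (beyond-backward (blk y) x<y (far-block y x by<bx (sym same-parity)))

  colour : Fin n → Bool
  colour p = blk p % 2 ℕ.≡ᵇ 0

  colour-parity : ∀ p {b} → colour p ≡ b → blk p % 2 ≡ (if b then 0 else 1)
  colour-parity p refl with blk p % 2 | %2-cases (blk p)
  ... | _ | inj₁ refl = refl
  ... | _ | inj₂ refl = refl

  c11 : C11 π
  c11 = colour , monotone true , monotone false
    where
    monotone : ∀ b p q → p < q → colour p ≡ b → colour q ≡ b → Trend (if b then 0 else 1) p q
    monotone b p q p<q cp cq = subst (λ k → Trend k p q) (colour-parity p cp)
      (same-parity-trend p q p<q (trans (colour-parity p cp) (sym (colour-parity q cq))))

  Placement : ℕ → Fin n → Fin n → Set
  Placement r x y = blk y ≡ blk x ⊎ (blk y ≡ suc (blk x) × Adjacent r x y) ⊎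
                    (suc (suc (blk x)) ≤ blk y × Beyond r x y)

  placement : ∀ x y {r} → suc (blk x) % 4 ≡ r → blk x ≤ blk y → Placement r x y
  placement x y refl bx≤by with ℕ.m≤n⇒m<n∨m≡n bx≤by
  ... | inj₂ e = inj₁ (sym e)
  ... | inj₁ bx<by with blk y ℕ.≟ suc (blk x)
  ...   | yes e = inj₂ (inj₁ (e , proj₁ (later-block x y bx<by) e))
  ...   | no ne = inj₂ (inj₂ (far , proj₂ (later-block x y bx<by) far))
    where
    far : suc (suc (blk x)) ≤ blk y
    far = ℕ.≤∧≢⇒< bx<by (ne ∘ sym)

  same-unless-adjacent : ∀ {x y} r → Placement r x y → ¬ Adjacent r x y → blk y ≡ blk x
  same-unless-adjacent r (inj₁ e) _ = e
  same-unless-adjacent r (inj₂ (inj₁ (_ , adjacent))) ¬adjacent = ⊥-elim (¬adjacent adjacent)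
  same-unless-adjacent r (inj₂ (inj₂ (_ , beyond))) ¬adjacent = ⊥-elim (¬adjacent (beyond⇒adjacent r beyond))

  next-unless-beyond : ∀ {x y} r → Placement r x y → blk y ≢ blk x → ¬ Beyond r x y → blk y ≡ suc (blk x)
  next-unless-beyond r (inj₁ e) ne _ = ⊥-elim (ne e)
  next-unless-beyond r (inj₂ (inj₁ (e , _))) _ _ = e
  next-unless-beyond r (inj₂ (inj₂ (_ , beyond))) _ ¬beyond = ⊥-elim (¬beyond beyond)

  adjacent-unless-same : ∀ {x y} r → Placement r x y → blk y ≢ blk x → ¬ Adjacent r x y → ⊥
  adjacent-unless-same r placed ne ¬adjacent = ne (same-unless-adjacent r placed ¬adjacent)

  trend-in-block : ∀ y z {k} → y < z → blk y ≡ blk z → blk y % 2 ≡ k → Trend k y z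
  trend-in-block y z y<z e parity = subst (λ k → Trend k y z) parity (same-block y z y<z e)

  minimum-of-four : ∀ a b c d → (a ≤ b × a ≤ c × a ≤ d) ⊎ (b ≤ a × b ≤ c × b ≤ d) ⊎
                                (c ≤ a × c ≤ b × c ≤ d) ⊎ (d ≤ a × d ≤ b × d ≤ c)
  minimum-of-four a b c d with ℕ.≤-total a b | ℕ.≤-total c d
  ... | inj₁ a≤b | inj₁ c≤d with ℕ.≤-total a c
  ...   | inj₁ a≤c = inj₁ (a≤b , a≤c , ℕ.≤-trans a≤c c≤d)
  ...   | inj₂ c≤a = inj₂ (inj₂ (inj₁ (c≤a , ℕ.≤-trans c≤a a≤b , c≤d)))
  minimum-of-four a b c d | inj₁ a≤b | inj₂ d≤c with ℕ.≤-total a d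
  ...   | inj₁ a≤d = inj₁ (a≤b , ℕ.≤-trans a≤d d≤c , a≤d)
  ...   | inj₂ d≤a = inj₂ (inj₂ (inj₂ (d≤a , ℕ.≤-trans d≤a a≤b , d≤c)))
  minimum-of-four a b c d | inj₂ b≤a | inj₁ c≤d with ℕ.≤-total b c
  ...   | inj₁ b≤c = inj₂ (inj₁ (b≤a , b≤c , ℕ.≤-trans b≤c c≤d))
  ...   | inj₂ c≤b = inj₂ (inj₂ (inj₁ (ℕ.≤-trans c≤b b≤a , c≤b , c≤d)))
  minimum-of-four a b c d | inj₂ b≤a | inj₂ d≤c with ℕ.≤-total b d
  ...   | inj₁ b≤d = inj₂ (inj₁ (b≤a , ℕ.≤-trans b≤d d≤c , b≤d))
  ...   | inj₂ d≤b = inj₂ (inj₂ (inj₂ (ℕ.≤-trans d≤b b≤a , d≤b , d≤c)))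

  -- Let A, B, C, D be an occurrence of 3142 and look at the element in the lowest block:
  -- by condition (b), according to the residue of the following block, two of the other
  -- three elements are forced into a common block where they violate its monotonicity,
  -- or one of them violates its adjacency condition.
  module Occurrence (g : Fin 4 → Fin n) (g↑ : ∀ i j → i < j → g i < g j)
      (same-order : ∀ i j → (p3142 ⟨$⟩ʳ i < p3142 ⟨$⟩ʳ j) ⇔ (value (g i) < value (g j))) where
    A B C D : Fin n
    A = g 0F
    B = g 1F
    C = g 2F
    D = g 3F
    A<B : A < B
    A<B = g↑ 0F 1F (s≤s z≤n)
    B<C : B < C
    B<C = g↑ 1F 2F (s≤s (s≤s z≤n))
    C<D : C < D
    C<D = g↑ 2F 3F (s≤s (s≤s (s≤s z≤n)))
    A<C : A < C
    A<C = ℕ.<-trans A<B B<C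
    A<D : A < D
    A<D = ℕ.<-trans A<C C<D
    B<D : B < D
    B<D = ℕ.<-trans B<C C<D
    vB<vD : Below B D
    vB<vD = Equivalence.to (same-order 1F 3F) (s≤s z≤n)
    vD<vA : Below D A
    vD<vA = Equivalence.to (same-order 3F 0F) (s≤s (s≤s z≤n))
    vA<vC : Below A C
    vA<vC = Equivalence.to (same-order 0F 2F) (s≤s (s≤s (s≤s z≤n)))
    vB<vA : Below B A
    vB<vA = ℕ.<-trans vB<vD vD<vA
    vD<vC : Below D C
    vD<vC = ℕ.<-trans vD<vA vA<vC
    vB<vC : Below B C
    vB<vC = ℕ.<-trans vB<vA vA<vC

    asym : ∀ {a b : Fin n} → a < b → ¬ b < a
    asym = Fin.<-asym

    parity-along : ∀ {y a k} → blk y ≡ a → a % 2 ≡ k → blk y % 2 ≡ k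
    parity-along e parity = trans (cong (_% 2) e) parity

    separated-from-left : ∀ {x y k} → x < y → ¬ Trend k x y → blk x % 2 ≡ k → blk y ≢ blk x
    separated-from-left x<y ¬trend parity e = ¬trend (trend-in-block _ _ x<y (sym e) parity)

    separated-from-right : ∀ {x y k} → x < y → ¬ Trend k x y → blk y % 2 ≡ k → blk x ≢ blk y
    separated-from-right x<y ¬trend parity e = ¬trend (trend-in-block _ _ x<y e (parity-along e parity))

    A-lowest : blk A ≤ blk B → blk A ≤ blk C → blk A ≤ blk D → ⊥
    A-lowest mB mC mD with residue-cases (blk A)
    ... | inj₂ (pa , ps , inj₁ r) = asym vB<vD (trend-in-block B D B<D (trans bB (sym bD)) (parity-along bB pa))
      where
        bB : blk B ≡ blk A
        bB = same-unless-adjacent 0 (placement A B r mB) (asym vB<vA)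
        bD : blk D ≡ blk A
        bD = same-unless-adjacent 0 (placement A D r mD) (asym vD<vA)
    ... | inj₂ (pa , ps , inj₂ r) = adjacent-unless-same 2 (placement A C r mC)
            (separated-from-left A<C (asym vA<vC) pa) (asym vA<vC)
    ... | inj₁ (pa , ps , inj₁ r) = adjacent-unless-same 1 (placement A B r mB)
            (separated-from-left A<B (asym vB<vA) pa) (asym A<B)
    ... | inj₁ (pa , ps , inj₂ r) = asym vB<vD (trend-in-block B D B<D (trans bB (sym bD)) (parity-along bB ps))
      where
        bB : blk B ≡ suc (blk A)
        bB = next-unless-beyond 3 (placement A B r mB) (separated-from-left A<B (asym vB<vA) pa) (λ q → asym vB<vA (proj₂ q))
        bD : blk D ≡ suc (blk A)
        bD = next-unless-beyond 3 (placement A D r mD) (separated-from-left A<D (asym vD<vA) pa) (λ q → asym vD<vA (proj₂ q))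

    B-lowest : blk B ≤ blk A → blk B ≤ blk C → blk B ≤ blk D → ⊥
    B-lowest mA mC mD with residue-cases (blk B)
    ... | inj₂ (pa , ps , inj₁ r) = asym vD<vC (trend-in-block C D C<D (trans bC (sym bD)) (parity-along bC ps))
      where
        bC : blk C ≡ suc (blk B)
        bC = next-unless-beyond 0 (placement B C r mC) (separated-from-left B<C (asym vB<vC) pa) (λ q → asym B<C (proj₂ q))
        bD : blk D ≡ suc (blk B)
        bD = next-unless-beyond 0 (placement B D r mD) (separated-from-left B<D (asym vB<vD) pa) (λ q → asym B<D (proj₂ q))
    ... | inj₂ (pa , ps , inj₂ r) = adjacent-unless-same 2 (placement B C r mC)
            (separated-from-left B<C (asym vB<vC) pa) (asym vB<vC)
    ... | inj₁ (pa , ps , inj₁ r) = asym vD<vC (trend-in-block C D C<D (trans bC (sym bD)) (parity-along bC pa))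
      where
        bC : blk C ≡ blk B
        bC = same-unless-adjacent 1 (placement B C r mC) (asym B<C)
        bD : blk D ≡ blk B
        bD = same-unless-adjacent 1 (placement B D r mD) (asym B<D)
    ... | inj₁ (pa , ps , inj₂ r) = adjacent-unless-same 3 (placement B A r mA)
            (separated-from-right A<B (asym vB<vA) pa) (asym A<B)

    C-lowest : blk C ≤ blk A → blk C ≤ blk B → blk C ≤ blk D → ⊥
    C-lowest mA mB mD with residue-cases (blk C)
    ... | inj₂ (pa , ps , inj₁ r) = adjacent-unless-same 0 (placement C A r mA)
            (separated-from-right A<C (asym vA<vC) pa) (asym vA<vC)
    ... | inj₂ (pa , ps , inj₂ r) = asym vB<vA (trend-in-block A B A<B (trans bA (sym bB)) (parity-along bA ps))
      where
        bA : blk A ≡ suc (blk C)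
        bA = next-unless-beyond 2 (placement C A r mA) (separated-from-right A<C (asym vA<vC) pa) (λ q → asym A<C (proj₂ q))
        bB : blk B ≡ suc (blk C)
        bB = next-unless-beyond 2 (placement C B r mB) (separated-from-right B<C (asym vB<vC) pa) (λ q → asym B<C (proj₂ q))
    ... | inj₁ (pa , ps , inj₁ r) = adjacent-unless-same 1 (placement C D r mD)
            (separated-from-left C<D (asym vD<vC) pa) (asym C<D)
    ... | inj₁ (pa , ps , inj₂ r) = asym vB<vA (trend-in-block A B A<B (trans bA (sym bB)) (parity-along bA pa))
      where
        bA : blk A ≡ blk C
        bA = same-unless-adjacent 3 (placement C A r mA) (asym A<C)
        bB : blk B ≡ blk C
        bB = same-unless-adjacent 3 (placement C B r mB) (asym B<C)

    D-lowest : blk D ≤ blk A → blk D ≤ blk B → blk D ≤ blk C → ⊥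
    D-lowest mA mB mC with residue-cases (blk D)
    ... | inj₂ (pa , ps , inj₁ r) = adjacent-unless-same 0 (placement D B r mB)
            (separated-from-right B<D (asym vB<vD) pa) (asym vB<vD)
    ... | inj₂ (pa , ps , inj₂ r) = asym vA<vC (trend-in-block A C A<C (trans bA (sym bC)) (parity-along bA pa))
      where
        bA : blk A ≡ blk D
        bA = same-unless-adjacent 2 (placement D A r mA) (asym vD<vA)
        bC : blk C ≡ blk D
        bC = same-unless-adjacent 2 (placement D C r mC) (asym vD<vC)
    ... | inj₁ (pa , ps , inj₁ r) = asym vA<vC (trend-in-block A C A<C (trans bA (sym bC)) (parity-along bA ps))
      where
        bA : blk A ≡ suc (blk D)
        bA = next-unless-beyond 1 (placement D A r mA) (separated-from-right A<D (asym vD<vA) pa) (λ q → asym vD<vA (proj₂ q))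
        bC : blk C ≡ suc (blk D)
        bC = next-unless-beyond 1 (placement D C r mC) (separated-from-right C<D (asym vD<vC) pa) (λ q → asym vD<vC (proj₂ q))
    ... | inj₁ (pa , ps , inj₂ r) = adjacent-unless-same 3 (placement D A r mA)
            (separated-from-right A<D (asym vD<vA) pa) (asym A<D)

    impossible : ⊥
    impossible with minimum-of-four (blk A) (blk B) (blk C) (blk D)
    ... | inj₁ (x , y , z)                   = A-lowest x y z
    ... | inj₂ (inj₁ (x , y , z))            = B-lowest x y z
    ... | inj₂ (inj₂ (inj₁ (x , y , z)))     = C-lowest x y z
    ... | inj₂ (inj₂ (inj₂ (x , y , z)))     = D-lowest x y z

  av : Av3142 π
  av (g , g↑ , same-order) = Occurrence.impossible g g↑ same-order

lemma8 : (n : ℕ) (π : Permutation′ n) →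
  ((C11 π × Av3142 π) ⇔ HasSpiralDecomposition π) ×
  ((C11 π × Av3142 π) →
    Σ ℕ λ m → Σ (Fin n → ℕ) λ blk →
      IsSpiralDecomposition π m blk × NoFourConsecutiveEmpty π m blk)
lemma8 n π =
  mk⇔ (λ (c11 , av) → let open ToSpiral π c11 av in m , blk , isSpiral)
      (λ (m , blk , spiral) → let open FromSpiral π m blk spiral in c11 , av) ,
  λ (c11 , av) → let open ToSpiral π c11 av in m , blk , isSpiral , noFour
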